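{- Let $k$ be a positive integer. If $G$ is a strongly edge-colored graph whose average degree satisfies $d(G)=\frac{1}{|V(G)|}\sum_{v\in V(G)} d(v)\geq 2k-1$, then $G$ contains a rainbow matching of size at least $k$ (i.e., $r(G)\ge k$).
   Context: All graphs are finite, simple and undirected. An edge-colored graph is strongly edge-colored if for each color, the set of edges of that color forms an induced matching in $G$ (in particular the coloring is proper). A rainbow matching is a matching in which no two edges have the same color, and $r(G)$ denotes the maximum size of a rainbow matching in $G$. -}

module Defs where

open import Data.Nat using (ℕ; _*_; _∸_; _≥_; _+_)
open import Data.Fin using (Fin)
open import Data.List using (List; length; filter; map)
open import Data.Nat.ListAction using (sum)
open import Data.List.Base using ()
open import Data.Fin.Base using ()
open import Data.Product using (Σ; _×_; _,_; proj₁; proj₂)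
open import Data.Sum using (_⊎_)
open import Relation.Nullary using (¬_)
open import Relation.Binary using (Rel; Decidable)
open import Relation.Binary.PropositionalEquality using (_≡_; _≢_)
open import Data.List using (allFin)
open import Level using (0ℓ)

record Graph (n : ℕ) : Set₁ where
  field
    Adj     : Fin n → Fin n → Set
    adj?    : Decidable Adj
    sym     : ∀ {u v} → Adj u v → Adj v u
    irrefl  : ∀ {u} → ¬ Adj u u

open Graph public

degree : ∀ {n} → Graph n → Fin n → ℕ
degree G v = length (filter (adj? G v) (allFin _))

degreeSum : ∀ {n} → Graph n → ℕ
degreeSum {n} G = sum (map (degree G) (allFin n))

-- An edge colouring (colours are natural numbers): a colour for each ordered
-- pair of vertices, symmetric, so that it is a function on (unordered) edges.
-- Values on non-adjacent pairs are irrelevant.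
record EdgeColouring {n : ℕ} (G : Graph n) : Set where
  field
    col    : Fin n → Fin n → ℕ
    colSym : ∀ u v → col u v ≡ col v u

open EdgeColouring public

SameEdge : ∀ {n} → Fin n → Fin n → Fin n → Fin n → Set
SameEdge u v x y = (u ≡ x × v ≡ y) ⊎ (u ≡ y × v ≡ x)

-- Strong edge colouring: each colour class is an induced matching, i.e. two
-- distinct edges of the same colour are vertex-disjoint and no edge of G joins them.
IsStrong : ∀ {n} (G : Graph n) → EdgeColouring G → Set
IsStrong {n} G c =
  ∀ (u v x y : Fin n) → Adj G u v → Adj G x y → col c u v ≡ col c x y →
    SameEdge u v x y ⊎
    ((u ≢ x × u ≢ y × v ≢ x × v ≢ y) ×
     (¬ Adj G u x × ¬ Adj G u y × ¬ Adj G v x × ¬ Adj G v y))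

record RainbowMatching {n : ℕ} (G : Graph n) (c : EdgeColouring G) (k : ℕ) : Set where
  field
    edge      : Fin k → Fin n × Fin n
    isEdge    : ∀ i → Adj G (proj₁ (edge i)) (proj₂ (edge i))
    disjoint  : ∀ i j → i ≢ j →
                  proj₁ (edge i) ≢ proj₁ (edge j) × proj₁ (edge i) ≢ proj₂ (edge j) ×
                  proj₂ (edge i) ≢ proj₁ (edge j) × proj₂ (edge i) ≢ proj₂ (edge j)
    rainbow   : ∀ i j → i ≢ j →
                  col c (proj₁ (edge i)) (proj₂ (edge i)) ≢ col c (proj₁ (edge j)) (proj₂ (edge j))

-- Some vertex u has degree at least the average, 2k − 1; deleting it lowers the
-- degree sum by 2 deg u ≤ 2(n − 1), so G − u still has average degree at least 2k − 3 and, by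
-- induction, a rainbow matching M of size k − 1. Because the colouring is strong, each edge xy of M
-- rules out at most two neighbours w of u as partners (w ∈ {x, y}, or uw coloured like xy): if u is
-- adjacent to x or y, an edge uw coloured like xy must be xy itself; otherwise at most one edge at u
-- has that colour. As deg u > 2(k − 1), some neighbour w of u is free, and M + uw is rainbow.

module Submission where

open import Defs renaming (sym to adj-sym)
open import Data.Nat using (ℕ; zero; suc; _+_; _*_; _∸_; _≤_; _<_; _≥_; z≤n; s≤s; _≤?_)
import Data.Nat.Properties as ℕ
open import Data.Nat.Tactic.RingSolver using (solve-∀)
open import Algebra.Properties.CommutativeSemigroup ℕ.+-commutativeSemigroup using (interchange)
open import Algebra.Properties.CommutativeMonoid.Sum ℕ.+-0-commutativeMonoid
  using (sum; sum-remove; sum-cong-≗; sum-syntax)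
open import Data.Fin using (Fin; punchIn)
open import Data.Fin.Properties using (_≟_; any?; punchInᵢ≢i; punchIn-injective)
open import Data.List using (tabulate; allFin; filter; length; map)
open import Data.List.Properties using (map-tabulate)
import Data.Nat.ListAction as List
open import Data.Product using (_×_; _,_; proj₁; proj₂; ∃)
open import Data.Sum using (_⊎_; inj₁; inj₂; [_,_])
open import Data.Empty using (⊥-elim)
open import Function using (_∘_; id)
open import Relation.Nullary using (¬_; Dec; yes; no; contradiction)
open import Relation.Nullary.Decidable using (_⊎-dec_; ¬?)
open import Level using (0ℓ)
open import Relation.Unary using (Pred; _⊆_; Decidable)
open import Relation.Unary.Properties using (_∪?_; _∩?_)
open import Relation.Binary.PropositionalEquality
  using (_≡_; _≢_; refl; sym; trans; cong; cong₂; subst; subst₂; module ≡-Reasoning)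

sum-const : ∀ n c → ∑[ i < n ] c ≡ n * c
sum-const zero    c = refl
sum-const (suc n) c = cong (c +_) (sum-const n c)

sum-+ : ∀ {n} (f g : Fin n → ℕ) → ∑[ i < n ] (f i + g i) ≡ sum f + sum g
sum-+ {zero}  f g = refl
sum-+ {suc n} f g = trans (cong (f Fin.zero + g Fin.zero +_) (sum-+ (f ∘ Fin.suc) (g ∘ Fin.suc)))
                          (interchange (f Fin.zero) (g Fin.zero) _ _)

sum-mono-≤ : ∀ {n} {f g : Fin n → ℕ} → (∀ i → f i ≤ g i) → sum f ≤ sum g
sum-mono-≤ {zero}  f≤g = z≤n
sum-mono-≤ {suc n} f≤g = ℕ.+-mono-≤ (f≤g Fin.zero) (sum-mono-≤ (f≤g ∘ Fin.suc))

sum-comm : ∀ {m n} (f : Fin m → Fin n → ℕ) →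
           ∑[ i < m ] ∑[ j < n ] f i j ≡ ∑[ j < n ] ∑[ i < m ] f i j
sum-comm {zero}  {n} f = sym (trans (sum-const n 0) (ℕ.*-zeroʳ n))
sum-comm {suc m} {n} f = trans (cong (sum (f Fin.zero) +_) (sum-comm (f ∘ Fin.suc)))
                               (sym (sum-+ (f Fin.zero) _))

≤-sum : ∀ {n} (f : Fin n → ℕ) i → f i ≤ sum f
≤-sum {suc n} f i = ℕ.≤-trans (ℕ.m≤m+n (f i) _) (ℕ.≤-reflexive (sym (sum-remove {i = i} f)))

∃-≥-mean : ∀ n c (f : Fin (suc n) → ℕ) → c * suc n ≤ sum f → ∃ λ i → c ≤ f i
∃-≥-mean n       c f mean≤sum with c ≤? f Fin.zero
... | yes c≤f₀ = Fin.zero , c≤f₀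
∃-≥-mean zero    c f mean≤sum | no c≰f₀ =
  ⊥-elim (c≰f₀ (subst₂ _≤_ (ℕ.*-identityʳ c) (ℕ.+-identityʳ _) mean≤sum))
∃-≥-mean (suc n) c f mean≤sum | no c≰f₀ =
  let i , c≤fᵢ = ∃-≥-mean n c (f ∘ Fin.suc) (ℕ.+-cancelˡ-≤ c _ _ rest) in Fin.suc i , c≤fᵢ
  where
  rest : c + c * suc n ≤ c + sum (f ∘ Fin.suc)
  rest = ℕ.≤-trans (ℕ.≤-reflexive (sym (ℕ.*-suc c (suc n))))
           (ℕ.≤-trans mean≤sum (ℕ.+-monoˡ-≤ _ (ℕ.<⇒≤ (ℕ.≰⇒> c≰f₀))))

indicator : ∀ {p} {P : Set p} → Dec P → ℕ
indicator (yes _) = 1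
indicator (no _)  = 0

indicator≤1 : ∀ {p} {P : Set p} (P? : Dec P) → indicator P? ≤ 1
indicator≤1 (yes _) = ℕ.≤-refl
indicator≤1 (no _)  = z≤n

indicator-yes : ∀ {p} {P : Set p} → P → (P? : Dec P) → indicator P? ≡ 1
indicator-yes _ (yes _) = refl
indicator-yes p (no ¬p) = ⊥-elim (¬p p)

indicator-no : ∀ {p} {P : Set p} → ¬ P → (P? : Dec P) → indicator P? ≡ 0
indicator-no ¬p (yes p) = ⊥-elim (¬p p)
indicator-no _  (no _)  = refl

indicator-mono : ∀ {p q} {P : Set p} {Q : Set q} → (P → Q) →
                 (P? : Dec P) (Q? : Dec Q) → indicator P? ≤ indicator Q?
indicator-mono P⇒Q (yes p) Q? = ℕ.≤-reflexive (sym (indicator-yes (P⇒Q p) Q?))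
indicator-mono P⇒Q (no _)  Q? = z≤n

count : ∀ {n p} {P : Pred (Fin n) p} → Decidable P → ℕ
count {n} P? = ∑[ i < n ] indicator (P? i)

module _ {n p q} {P : Pred (Fin n) p} {Q : Pred (Fin n) q} (P? : Decidable P) (Q? : Decidable Q) where

  count-mono : P ⊆ Q → count P? ≤ count Q?
  count-mono P⊆Q = sum-mono-≤ (λ i → indicator-mono P⊆Q (P? i) (Q? i))

  count-∪ : count (P? ∪? Q?) ≤ count P? + count Q?
  count-∪ = ℕ.≤-trans (sum-mono-≤ pointwise) (ℕ.≤-reflexive (sum-+ (indicator ∘ P?) (indicator ∘ Q?)))
    where
    pointwise : ∀ i → indicator ((P? ∪? Q?) i) ≤ indicator (P? i) + indicator (Q? i)
    pointwise i with P? i | Q? i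
    ... | yes _ | _     = s≤s z≤n
    ... | no _  | yes _ = s≤s z≤n
    ... | no _  | no _  = z≤n

count-cong : ∀ {n p q} {P : Pred (Fin n) p} {Q : Pred (Fin n) q} (P? : Decidable P) (Q? : Decidable Q) →
             P ⊆ Q → Q ⊆ P → count P? ≡ count Q?
count-cong P? Q? P⊆Q Q⊆P = ℕ.≤-antisym (count-mono P? Q? P⊆Q) (count-mono Q? P? Q⊆P)

module _ {n p} {P : Pred (Fin n) p} (P? : Decidable P) where

  count≤n : count P? ≤ n
  count≤n = ℕ.≤-trans (sum-mono-≤ (indicator≤1 ∘ P?))
                      (ℕ.≤-reflexive (trans (sum-const n 1) (ℕ.*-identityʳ n)))

  count-∅ : (∀ i → ¬ P i) → count P? ≡ 0
  count-∅ ¬P = trans (sum-cong-≗ (λ i → indicator-no (¬P i) (P? i))) (trans (sum-const n 0) (ℕ.*-zeroʳ n))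

count-≡ : ∀ {n} (a : Fin n) → count (_≟ a) ≡ 1
count-≡ {suc n} a = begin
  count (_≟ a)
    ≡⟨ sum-remove {i = a} (indicator ∘ (_≟ a)) ⟩
  indicator (a ≟ a) + count (λ x → punchIn a x ≟ a)
    ≡⟨ cong₂ _+_ (indicator-yes refl (a ≟ a)) (count-∅ _ (punchInᵢ≢i a)) ⟩
  1
    ∎
  where open ≡-Reasoning

module _ {n p} {P : Pred (Fin n) p} (P? : Decidable P) where

  count≤2 : ∀ a b → (∀ {w} → P w → w ≡ a ⊎ w ≡ b) → count P? ≤ 2
  count≤2 a b P⊆ab = ℕ.≤-trans (count-mono P? ((_≟ a) ∪? (_≟ b)) P⊆ab)
                     (ℕ.≤-trans (count-∪ (_≟ a) (_≟ b)) (ℕ.≤-reflexive (cong₂ _+_ (count-≡ a) (count-≡ b))))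

  count≤1 : (∀ {w w′} → P w → P w′ → w ≡ w′) → count P? ≤ 1
  count≤1 unique with any? P?
  ... | yes (w₀ , p₀) = ℕ.≤-trans (count-mono P? (_≟ w₀) (λ p → unique p p₀)) (ℕ.≤-reflexive (count-≡ w₀))
  ... | no ∄P         = ℕ.≤-trans (ℕ.≤-reflexive (count-∅ P? (λ w p → ∄P (w , p)))) z≤n

  count-≤-∑count : ∀ {k q} {Q : Fin k → Pred (Fin n) q} (Q? : ∀ i → Decidable (Q i)) →
                   (∀ {w} → P w → ∃ λ i → Q i w) → count P? ≤ ∑[ i < k ] count (Q? i)
  count-≤-∑count {k} Q? cover = ℕ.≤-trans (sum-mono-≤ pointwise)
                                  (ℕ.≤-reflexive (sum-comm (λ w i → indicator (Q? i w))))
    where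
    pointwise : ∀ w → indicator (P? w) ≤ ∑[ i < k ] indicator (Q? i w)
    pointwise w with P? w
    ... | no _  = z≤n
    ... | yes p = let i , q = cover p in
      ℕ.≤-trans (ℕ.≤-reflexive (sym (indicator-yes q (Q? i w)))) (≤-sum (λ i → indicator (Q? i w)) i)

sum-tabulate : ∀ {n} (f : Fin n → ℕ) → List.sum (tabulate f) ≡ sum f
sum-tabulate {zero}  f = refl
sum-tabulate {suc n} f = cong (f Fin.zero +_) (sum-tabulate (f ∘ Fin.suc))

length-filter-tabulate : ∀ {n m p} {P : Pred (Fin m) p} (P? : Decidable P) (g : Fin n → Fin m) →
                         length (filter P? (tabulate g)) ≡ count (P? ∘ g)
length-filter-tabulate {zero}  P? g = refl
length-filter-tabulate {suc n} P? g with P? (g Fin.zero)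
... | yes _ = cong suc (length-filter-tabulate P? (g ∘ Fin.suc))
... | no _  = length-filter-tabulate P? (g ∘ Fin.suc)

deg : ∀ {n} → Graph n → Fin n → ℕ
deg G v = count (adj? G v)

degSum : ∀ {n} → Graph n → ℕ
degSum G = sum (deg G)

degreeSum≡degSum : ∀ {n} (G : Graph n) → degreeSum G ≡ degSum G
degreeSum≡degSum {n} G = begin
  List.sum (map (degree G) (allFin n)) ≡⟨ cong List.sum (map-tabulate id (degree G)) ⟩
  List.sum (tabulate (degree G))      ≡⟨ sum-tabulate (degree G) ⟩
  sum (degree G)                      ≡⟨ sum-cong-≗ (λ v → length-filter-tabulate (adj? G v) id) ⟩
  degSum G                            ∎
  where open ≡-Reasoning

_-_ : ∀ {m} → Graph (suc m) → Fin (suc m) → Graph m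
G - u = record
  { Adj    = λ x y → Adj G (punchIn u x) (punchIn u y)
  ; adj?   = λ x y → adj? G (punchIn u x) (punchIn u y)
  ; sym    = adj-sym G
  ; irrefl = irrefl G
  }

restrict : ∀ {m} {G : Graph (suc m)} → EdgeColouring G → (u : Fin (suc m)) → EdgeColouring (G - u)
restrict c u = record
  { col    = λ x y → col c (punchIn u x) (punchIn u y)
  ; colSym = λ x y → colSym c (punchIn u x) (punchIn u y)
  }

isStrong-restrict : ∀ {m} (G : Graph (suc m)) (c : EdgeColouring G) (u : Fin (suc m)) →
                    IsStrong G c → IsStrong (G - u) (restrict c u)
isStrong-restrict G c u strong x y z w xy zw same
  with strong (punchIn u x) (punchIn u y) (punchIn u z) (punchIn u w) xy zw same
... | inj₁ (inj₁ (x≡z , y≡w)) = inj₁ (inj₁ (punchIn-injective u _ _ x≡z , punchIn-injective u _ _ y≡w))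
... | inj₁ (inj₂ (x≡w , y≡z)) = inj₁ (inj₂ (punchIn-injective u _ _ x≡w , punchIn-injective u _ _ y≡z))
... | inj₂ ((x≢z , x≢w , y≢z , y≢w) , nonadjacent) =
  inj₂ ((x≢z ∘ cong (punchIn u) , x≢w ∘ cong (punchIn u) ,
         y≢z ∘ cong (punchIn u) , y≢w ∘ cong (punchIn u)) , nonadjacent)

deg≡count-punchIn : ∀ {m} (G : Graph (suc m)) u → deg G u ≡ count (λ x → adj? G u (punchIn u x))
deg≡count-punchIn G u = trans (sum-remove {i = u} (indicator ∘ adj? G u))
                              (cong (_+ count (λ x → adj? G u (punchIn u x))) (indicator-no (irrefl G) (adj? G u u)))

deg≤ : ∀ {m} (G : Graph (suc m)) u → deg G u ≤ m
deg≤ G u = ℕ.≤-trans (ℕ.≤-reflexive (deg≡count-punchIn G u)) (count≤n _)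

degSum-remove : ∀ {m} (G : Graph (suc m)) u → degSum G ≡ deg G u + deg G u + degSum (G - u)
degSum-remove G u = begin
  degSum G
    ≡⟨ sum-remove {i = u} (deg G) ⟩
  deg G u + ∑[ x < _ ] deg G (punchIn u x)
    ≡⟨ cong (deg G u +_) (sum-cong-≗ (λ x → sum-remove {i = u} (indicator ∘ adj? G (punchIn u x)))) ⟩
  deg G u + ∑[ x < _ ] (indicator (adj? G (punchIn u x) u) + deg (G - u) x)
    ≡⟨ cong (deg G u +_) (sum-+ _ (deg (G - u))) ⟩
  deg G u + (count (λ x → adj? G (punchIn u x) u) + degSum (G - u))
    ≡⟨ cong (λ d → deg G u + (d + degSum (G - u))) edges-at-u ⟩
  deg G u + (deg G u + degSum (G - u))
    ≡⟨ ℕ.+-assoc (deg G u) _ _ ⟨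
  deg G u + deg G u + degSum (G - u)
    ∎
  where
  open ≡-Reasoning
  edges-at-u : count (λ x → adj? G (punchIn u x) u) ≡ deg G u
  edges-at-u = trans (count-cong (λ x → adj? G (punchIn u x) u) (λ x → adj? G u (punchIn u x))
                                 (adj-sym G) (adj-sym G))
                     (sym (deg≡count-punchIn G u))

module Extension {m} (G : Graph (suc m)) (c : EdgeColouring G) (strong : IsStrong G c)
                 (u : Fin (suc m)) {k} (M : RainbowMatching (G - u) (restrict c u) k) where

  open RainbowMatching M

  x y : Fin k → Fin (suc m)
  x i = punchIn u (proj₁ (edge i))
  y i = punchIn u (proj₂ (edge i))

  -- The edge uw cannot be added to M next to its i-th edge.
  Blocks : Fin k → Pred (Fin (suc m)) 0ℓ
  Blocks i w = (w ≡ x i ⊎ w ≡ y i) ⊎ col c u w ≡ col c (x i) (y i)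

  blocks? : ∀ i → Decidable (Blocks i)
  blocks? i w = ((w ≟ x i) ⊎-dec (w ≟ y i)) ⊎-dec (col c u w ℕ.≟ col c (x i) (y i))

  extend : ∀ w → Adj G u w → (∀ i → ¬ Blocks i w) → RainbowMatching G c (suc k)
  extend w uw free = record { edge = edge′ ; isEdge = isEdge′ ; disjoint = disjoint′ ; rainbow = rainbow′ }
    where
    edge′ : Fin (suc k) → Fin (suc m) × Fin (suc m)
    edge′ Fin.zero    = u , w
    edge′ (Fin.suc i) = x i , y i

    isEdge′ : ∀ i → Adj G (proj₁ (edge′ i)) (proj₂ (edge′ i))
    isEdge′ Fin.zero    = uw
    isEdge′ (Fin.suc i) = isEdge i

    punchIn-≢ : ∀ {a b} → a ≢ b → punchIn u a ≢ punchIn u b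
    punchIn-≢ a≢b = a≢b ∘ punchIn-injective u _ _

    disjoint′ : ∀ i j → i ≢ j →
                proj₁ (edge′ i) ≢ proj₁ (edge′ j) × proj₁ (edge′ i) ≢ proj₂ (edge′ j) ×
                proj₂ (edge′ i) ≢ proj₁ (edge′ j) × proj₂ (edge′ i) ≢ proj₂ (edge′ j)
    disjoint′ Fin.zero    Fin.zero    i≢j = ⊥-elim (i≢j refl)
    disjoint′ Fin.zero    (Fin.suc j) _   = punchInᵢ≢i u _ ∘ sym , punchInᵢ≢i u _ ∘ sym ,
                                            free j ∘ inj₁ ∘ inj₁ , free j ∘ inj₁ ∘ inj₂
    disjoint′ (Fin.suc i) Fin.zero    _   = punchInᵢ≢i u _ , free i ∘ inj₁ ∘ inj₁ ∘ sym ,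
                                            punchInᵢ≢i u _ , free i ∘ inj₁ ∘ inj₂ ∘ sym
    disjoint′ (Fin.suc i) (Fin.suc j) i≢j =
      let p , q , r , s = disjoint i j (i≢j ∘ cong Fin.suc) in
      punchIn-≢ p , punchIn-≢ q , punchIn-≢ r , punchIn-≢ s

    rainbow′ : ∀ i j → i ≢ j →
               col c (proj₁ (edge′ i)) (proj₂ (edge′ i)) ≢ col c (proj₁ (edge′ j)) (proj₂ (edge′ j))
    rainbow′ Fin.zero    Fin.zero    i≢j = ⊥-elim (i≢j refl)
    rainbow′ Fin.zero    (Fin.suc j) _   = free j ∘ inj₂
    rainbow′ (Fin.suc i) Fin.zero    _   = free i ∘ inj₂ ∘ sym
    rainbow′ (Fin.suc i) (Fin.suc j) i≢j = rainbow i j (i≢j ∘ cong Fin.suc)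

  count-blocked≤2 : ∀ i → count (adj? G u ∩? blocks? i) ≤ 2
  count-blocked≤2 i with adj? G u (x i) ⊎-dec adj? G u (y i)
  ... | yes u~xy = count≤2 (adj? G u ∩? blocks? i) (x i) (y i) endpoint
    where
    endpoint : ∀ {w} → Adj G u w × Blocks i w → w ≡ x i ⊎ w ≡ y i
    endpoint (_  , inj₁ w∈xy) = w∈xy
    endpoint {w} (uw , inj₂ same) with strong u w (x i) (y i) uw (isEdge i) same
    ... | inj₁ (inj₁ (_ , w≡y)) = inj₂ w≡y
    ... | inj₁ (inj₂ (_ , w≡x)) = inj₁ w≡x
    ... | inj₂ (_ , u≁x , u≁y , _) = ⊥-elim ([ u≁x , u≁y ] u~xy)
  ... | no u≁xy = ℕ.≤-trans (count≤1 (adj? G u ∩? blocks? i) unique) (s≤s z≤n)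
    where
    colour : ∀ {w} → Adj G u w × Blocks i w → col c u w ≡ col c (x i) (y i)
    colour (uw , inj₁ (inj₁ refl)) = ⊥-elim (u≁xy (inj₁ uw))
    colour (uw , inj₁ (inj₂ refl)) = ⊥-elim (u≁xy (inj₂ uw))
    colour (_  , inj₂ same)        = same

    -- Two edges at u of the same colour coincide.
    unique : ∀ {w w′} → Adj G u w × Blocks i w → Adj G u w′ × Blocks i w′ → w ≡ w′
    unique {w} {w′} p p′ with strong u w u w′ (proj₁ p) (proj₁ p′) (trans (colour p) (sym (colour p′)))
    ... | inj₁ (inj₁ (_ , w≡w′))    = w≡w′
    ... | inj₁ (inj₂ (_ , refl))    = ⊥-elim (irrefl G (proj₁ p))
    ... | inj₂ ((u≢u , _) , _)      = ⊥-elim (u≢u refl)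

  extend-if-deg> : 2 * k < deg G u → RainbowMatching G c (suc k)
  extend-if-deg> big with any? (adj? G u ∩? (λ w → ¬? (any? λ i → blocks? i w)))
  ... | yes (w , uw , unblocked) = extend w uw (λ i b → unblocked (i , b))
  ... | no  none = ⊥-elim (ℕ.<⇒≱ big (begin
    deg G u                                   ≤⟨ count-≤-∑count (adj? G u) (λ i → adj? G u ∩? blocks? i) blocked ⟩
    ∑[ i < k ] count (adj? G u ∩? blocks? i)  ≤⟨ sum-mono-≤ count-blocked≤2 ⟩
    ∑[ i < k ] 2                              ≡⟨ sum-const k 2 ⟩
    k * 2                                     ≡⟨ ℕ.*-comm k 2 ⟩
    2 * k                                     ∎))
    where
    open ℕ.≤-Reasoning
    blocked : ∀ {w} → Adj G u w → ∃ λ i → Adj G u w × Blocks i w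
    blocked {w} uw with any? (λ i → blocks? i w)
    ... | yes (i , b)  = i , uw , b
    ... | no unblocked = ⊥-elim (none (w , uw , unblocked))

shrink-degree-bound : ∀ k n d S → (2 * suc k ∸ 1) * suc n ≤ d + d + S → d ≤ n → (2 * k ∸ 1) * n ≤ S
shrink-degree-bound zero    n d S _     _   = z≤n
shrink-degree-bound (suc k) n d S bound d≤n = ℕ.+-cancelʳ-≤ (n + n) _ _ (begin
  a * n + (n + n)                ≤⟨ ℕ.m≤m+n _ (2 + a) ⟩
  a * n + (n + n) + (2 + a)      ≡⟨ expand k n ⟨
  (2 * suc (suc k) ∸ 1) * suc n  ≤⟨ bound ⟩
  d + d + S                      ≤⟨ ℕ.+-monoˡ-≤ S (ℕ.+-mono-≤ d≤n d≤n) ⟩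
  n + n + S                      ≡⟨ ℕ.+-comm (n + n) S ⟩
  S + (n + n)                    ∎)
  where
  open ℕ.≤-Reasoning
  a : ℕ
  a = 2 * suc k ∸ 1
  -- 2 * suc k ∸ 1 computes to k + suc (k + 0), so the truncated subtraction is invisible to the solver.
  expand : ∀ k n → (suc k + suc (suc k + 0)) * suc n ≡ (k + suc (k + 0)) * n + (n + n) + (2 + (k + suc (k + 0)))
  expand = solve-∀

rainbowMatching : ∀ k m (G : Graph (suc m)) (c : EdgeColouring G) → IsStrong G c →
                  (2 * k ∸ 1) * suc m ≤ degSum G → RainbowMatching G c k
rainbowMatching zero    _       _ _ _      _     =
  record { edge = λ () ; isEdge = λ () ; disjoint = λ () ; rainbow = λ () }
rainbowMatching (suc k) zero    G c _      bound =
  let u , u-big = ∃-≥-mean zero (2 * suc k ∸ 1) (deg G) bound in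
  contradiction (ℕ.≤-trans (ℕ.m≤n+m (suc (k + 0)) k) (ℕ.≤-trans u-big (deg≤ G u))) λ ()
rainbowMatching (suc k) (suc m) G c strong bound =
  let u , u-big = ∃-≥-mean (suc m) (2 * suc k ∸ 1) (deg G) bound in
  Extension.extend-if-deg> G c strong u
    (rainbowMatching k m (G - u) (restrict c u) (isStrong-restrict G c u strong)
      (shrink-degree-bound k (suc m) (deg G u) (degSum (G - u))
        (subst ((2 * suc k ∸ 1) * suc (suc m) ≤_) (degSum-remove G u) bound) (deg≤ G u)))
    (subst (_≤ deg G u) (ℕ.+-suc k (k + 0)) u-big)

theorem4 : (k : ℕ) → 1 ≤ k → (n : ℕ) → 1 ≤ n → (G : Graph n) → (c : EdgeColouring G) →
    IsStrong G c → degreeSum G ≥ (2 * k ∸ 1) * n → RainbowMatching G c k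
theorem4 k _ (suc m) _ G c strong bound =
  rainbowMatching k m G c strong (subst ((2 * k ∸ 1) * suc m ≤_) (degreeSum≡degSum G) bound)
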